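{- Let $F$ be a strictly sign-coherent ice quiver whose mutable subquiver is a fork on $n$ mutable vertices. Then there exists a mutation sequence of length at most $2n+3$ ending in an ice quiver whose mutable subquiver is a fork and which has at least $n-1$ red vertices.
   Context: A quiver is a finite directed multigraph with no loops and no 2-cycles; for vertices $i,j$, $f_{ij}$ (or $q_{ij}$) denotes the number of arrows $i\to j$, counted negatively (as minus the number of arrows $j\to i$) if arrows go from $j$ to $i$. An ice quiver is a quiver whose vertices are partitioned into mutable and frozen; its mutable subquiver is the full subquiver on its mutable vertices. Mutation at a mutable vertex $k$: (1) for every path $a\to k\to b$ add an arrow $a\to b$; (2) reverse all arrows incident to $k$; (3) remove 2-cycles created. Mutations are only performed at mutable vertices. A mutable vertex $i$ is green if there is at least one arrow between $i$ and a frozen vertex and all such arrows point from $i$ to frozen vertices; red if there is at least one such arrow and all point from frozen vertices to $i$; blue if there are no arrows between $i$ and frozen vertices. An ice quiver is strictly sign-coherent if every ice quiver obtained from it by any sequence of mutations has every mutable vertex red or green. A quiver is abundant if there are at least two arrows between every pair of distinct vertices; acyclic if it has no directed cycle. A fork is an abundant quiver $F$ that is not acyclic and has a vertex $r$ (the point of return) such that: for all $i\in F^-(r)$ and $j\in F^+(r)$ we have $f_{ji}>f_{ir}$ and $f_{ji}>f_{rj}$, where $F^-(r)$ is the set of vertices with arrows to $r$ and $F^+(r)$ the set of vertices with arrows from $r$; and the full subquiver $F\setminus\{r\}$ on the remaining vertices is acyclic. -}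

module Defs where

open import Data.Nat using (ℕ)
open import Data.Fin using (Fin; _≟_)
open import Data.Sum using (_⊎_; inj₁; inj₂)
open import Data.Sum.Properties using (≡-dec)
open import Data.Integer using (ℤ; _+_; _*_; -_; _⊔_; _<_; _≤_; _>_; ∣_∣; 0ℤ; +_)
open import Data.Product using (Σ; _×_; ∃)
open import Data.List using (List; []; _∷_; foldl)
open import Relation.Nullary using (¬_; yes; no)
open import Relation.Binary.PropositionalEquality using (_≡_)

-- A (multi)quiver without loops and 2-cycles on a vertex type V is encoded by its
-- signed arrow-count matrix q : V → V → ℤ, q i j = #(i→j) (negative if arrows go j→i).
Matrix : Set → Set
Matrix V = V → V → ℤ

-- well-formedness: skew-symmetry (this forces q i i = 0, i.e. no loops)
IsQuiver : {V : Set} → Matrix V → Set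
IsQuiver q = ∀ i j → q j i ≡ - q i j

-- An ice quiver with n mutable vertices (inj₁) and m frozen vertices (inj₂).
Vtx : ℕ → ℕ → Set
Vtx n m = Fin n ⊎ Fin m

IceMatrix : ℕ → ℕ → Set
IceMatrix n m = Matrix (Vtx n m)

_≟V_ : ∀ {n m} → (a b : Vtx n m) → Relation.Nullary.Dec (a ≡ b)
_≟V_ = ≡-dec _≟_ _≟_

[_]₊ : ℤ → ℤ
[ x ]₊ = x ⊔ 0ℤ

-- Quiver mutation at mutable vertex k:
--  arrows incident to k reversed; otherwise add paths i→k→j and cancel with j→k→i.
mutate : ∀ {n m} → Fin n → IceMatrix n m → IceMatrix n m
mutate {n} {m} k q i j with i ≟V inj₁ k | j ≟V inj₁ k
... | yes _ | _     = - q i j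
... | no _  | yes _ = - q i j
... | no _  | no _  =
  q i j + ([ q i (inj₁ k) ]₊ * [ q (inj₁ k) j ]₊) + - ([ q j (inj₁ k) ]₊ * [ q (inj₁ k) i ]₊)

mutateSeq : ∀ {n m} → List (Fin n) → IceMatrix n m → IceMatrix n m
mutateSeq ks q = foldl (λ acc k → mutate k acc) q ks

Green : ∀ {n m} → IceMatrix n m → Fin n → Set
Green {n} {m} q i =
  Σ (Fin m) (λ j → 0ℤ < q (inj₁ i) (inj₂ j)) × (∀ j → 0ℤ ≤ q (inj₁ i) (inj₂ j))

Red : ∀ {n m} → IceMatrix n m → Fin n → Set
Red {n} {m} q i =
  Σ (Fin m) (λ j → q (inj₁ i) (inj₂ j) < 0ℤ) × (∀ j → q (inj₁ i) (inj₂ j) ≤ 0ℤ)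

StrictlySignCoherent : ∀ {n m} → IceMatrix n m → Set
StrictlySignCoherent {n} q =
  ∀ (ks : List (Fin n)) (i : Fin n) → Red (mutateSeq ks q) i ⊎ Green (mutateSeq ks q) i

mutablePart : ∀ {n m} → IceMatrix n m → Matrix (Fin n)
mutablePart q i j = q (inj₁ i) (inj₁ j)

data Path {V : Set} (q : Matrix V) : V → V → Set where
  edge : ∀ {a b} → 0ℤ < q a b → Path q a b
  step : ∀ {a b c} → 0ℤ < q a b → Path q b c → Path q a c

Acyclic : {V : Set} → Matrix V → Set
Acyclic {V} q = ∀ (a : V) → ¬ Path q a a

Abundant : {V : Set} → Matrix V → Set
Abundant {V} q = ∀ (i j : V) → ¬ i ≡ j → + 2 ≤ q i j ⊔ - q i j

-- the full subquiver on all vertices other than r, encoded by isolating r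
-- (r then lies on no directed path, so directed cycles are exactly those of F ∖ {r})
deleteVertex : ∀ {n} → Fin n → Matrix (Fin n) → Matrix (Fin n)
deleteVertex r q i j with i ≟ r | j ≟ r
... | no _ | no _ = q i j
... | _    | _    = 0ℤ

IsPointOfReturn : ∀ {n} → Matrix (Fin n) → Fin n → Set
IsPointOfReturn q r =
  (∀ i j → 0ℤ < q i r → 0ℤ < q r j → (q j i > q i r) × (q j i > q r j))
  × Acyclic (deleteVertex r q)

Fork : ∀ {n} → Matrix (Fin n) → Set
Fork {n} q = Abundant q × ¬ Acyclic q × Σ (Fin n) (IsPointOfReturn q)

module Submission where

-- Let r be the point of return of the fork F. Deleting r leaves an abundant acyclic quiver, i.e. a
-- transitive tournament w₁ → w₂ → ⋯, and r → w₁. Mutating at w₁ puts F into a normal form: a point of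
-- return y whose only out-neighbour is f, with f → v → y for every other vertex v and the other vertices
-- linearly ordered. Mutating at f (which swaps the roles of y and f), or at the first vertex u of the order
-- (u replaces y, and y joins the end of the order), preserves the normal form, because the new entries
-- a + x·y of the mutation rule dominate both x and y. By strict sign-coherence every mutable vertex is red
-- or green; mutation flips the colour of its vertex, keeps red every vertex with no arrow into a green one
-- and keeps green every vertex with no arrow from a red one. So at most three mutations at f make y red and
-- f green, after which each vertex of the order is made red by at most two mutations while f stays green:
-- 1 + 3 + 2(n − 2) mutations leave every vertex except f red.

open import Defs
open import Data.Nat using (ℕ)
import Data.Nat as ℕ
open import Data.Fin using (Fin; _≟_; punchIn; punchOut)
open import Data.Fin.Properties using (punchIn-injective; punchInᵢ≢i; punchIn-punchOut)
open import Data.List using (List; length; []; _∷_; _++_; tabulate)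
open import Data.List.Properties using (length-tabulate; ++-assoc)
open import Data.List.Membership.Propositional using (_∈_)
open import Data.List.Membership.Propositional.Properties using (∈-++⁺ˡ; ∈-++⁺ʳ; ∈-tabulate⁺)
open import Data.List.Relation.Unary.Any using (here; there)
open import Data.List.Relation.Unary.All using (All; []; _∷_)
import Data.List.Relation.Unary.All as All
import Data.List.Relation.Unary.All.Properties as All
open import Data.List.Relation.Unary.AllPairs using (AllPairs; []; _∷_)
import Data.List.Relation.Unary.AllPairs as AllPairs
import Data.List.Relation.Unary.AllPairs.Properties as AllPairs
open import Data.List.Relation.Unary.Linked.Properties using (Linked⇒AllPairs)
open import Data.List.Relation.Unary.Unique.Propositional using (Unique)
import Data.List.Relation.Unary.Unique.Propositional.Properties as Unique
open import Data.List.Relation.Binary.Permutation.Propositional using (_↭_; ↭-sym; ↭⇒↭ₛ)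
open import Data.List.Relation.Binary.Permutation.Propositional.Properties using (∈-resp-↭; All-resp-↭; ↭-length)
open import Data.List.Relation.Binary.Permutation.Setoid.Properties using (Unique-resp-↭)
import Data.List.Sort as Sort
open import Data.Empty using (⊥-elim)
open import Data.Product using (Σ; _×_; _,_; proj₁; proj₂; ∃)
import Data.Product
open import Data.Sum using (_⊎_; inj₁; inj₂; [_,_]′)
import Data.Sum
open import Data.Sum.Properties using (inj₁-injective)
open import Function using (_∘_; id)
open import Relation.Binary.Bundles using (DecTotalOrder)
open import Relation.Binary.Consequences using (total∧dec⇒dec)
open import Relation.Binary.Definitions using (DecidableEquality)
open import Relation.Binary.PropositionalEquality
  using (_≡_; _≢_; refl; sym; trans; cong; cong₂; subst; module ≡-Reasoning)
open import Relation.Binary.PropositionalEquality.Properties using (setoid; isEquivalence)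
open import Relation.Nullary using (¬_; Dec; yes; no)

Others : {A : Set} → A → A → A → Set
Others y f v = v ≢ y × v ≢ f

record Enumerates {A : Set} (P : A → Set) (xs : List A) : Set where
  field
    unique : Unique xs
    complete : ∀ {v} → P v → v ∈ xs
    sound : All P xs

module _ {A : Set} {P Q : A → Set} where

  Enumerates-cong : (∀ {v} → P v → Q v) → (∀ {v} → Q v → P v) → ∀ {xs} → Enumerates P xs → Enumerates Q xs
  Enumerates-cong P⇒Q Q⇒P e = record
    { unique = unique ; complete = complete ∘ Q⇒P ; sound = All.map P⇒Q sound }
    where open Enumerates e

module _ {A : Set} {P : A → Set} where

  AllPairs-mapWithin : ∀ {R S : A → A → Set} → (∀ {a b} → P a → P b → R a b → S a b) →
    ∀ {xs} → All P xs → AllPairs R xs → AllPairs S xs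
  AllPairs-mapWithin f [] [] = []
  AllPairs-mapWithin f (pa ∷ ps) (ra ∷ rs) =
    All.zipWith (λ (pb , r) → f pa pb r) (ps , ra) ∷ AllPairs-mapWithin f ps rs

  Enumerates-tail : ∀ {x xs} → Enumerates P (x ∷ xs) → Enumerates (λ v → v ≢ x × P v) xs
  Enumerates-tail {x} {xs} e = record
    { unique = AllPairs.tail unique
    ; complete = λ { (v≢x , pv) → tail-member v≢x (complete pv) }
    ; sound = All.zipWith (λ (x≢v , pv) → x≢v ∘ sym , pv) (AllPairs.head unique , All.tail sound)
    }
    where
    open Enumerates e
    tail-member : ∀ {v} → v ≢ x → v ∈ x ∷ xs → v ∈ xs
    tail-member v≢x (here v≡x) = ⊥-elim (v≢x v≡x)
    tail-member v≢x (there v∈xs) = v∈xs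

  Enumerates-resp-↭ : ∀ {xs ys} → xs ↭ ys → Enumerates P xs → Enumerates P ys
  Enumerates-resp-↭ xs↭ys e = record
    { unique = Unique-resp-↭ (setoid A) (↭⇒↭ₛ xs↭ys) unique
    ; complete = ∈-resp-↭ xs↭ys ∘ complete
    ; sound = All-resp-↭ xs↭ys sound
    }
    where open Enumerates e

AllPairs-trans : ∀ {A : Set} {R : A → A → Set} → (∀ {a b} → R a b → ¬ R b a) → ∀ {xs} → AllPairs R xs →
  ∀ {a b c} → a ∈ xs → b ∈ xs → c ∈ xs → R a b → R b c → R a c
AllPairs-trans asym (r ∷ rs) (here refl) b∈ (here refl) rab rbc = ⊥-elim (asym rab rbc)
AllPairs-trans asym (r ∷ rs) (here refl) b∈ (there c∈) rab rbc = All.lookup r c∈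
AllPairs-trans asym (r ∷ rs) (there a∈) (here refl) c∈ rab rbc = ⊥-elim (asym rab (All.lookup r a∈))
AllPairs-trans asym (r ∷ rs) (there a∈) (there b∈) (here refl) rab rbc = ⊥-elim (asym rbc (All.lookup r b∈))
AllPairs-trans asym (r ∷ rs) (there a∈) (there b∈) (there c∈) rab rbc = AllPairs-trans asym rs a∈ b∈ c∈ rab rbc

Enumerates-rotate : ∀ {A : Set} → DecidableEquality A → ∀ {y f u xs} → y ≢ f →
  Enumerates (Others y f) (u ∷ xs) → Enumerates (Others u f) (xs ++ y ∷ [])
Enumerates-rotate _≟_ {y} {f} {u} {xs} y≢f e = record
  { unique = Unique.++⁺ unique ([] ∷ []) λ { (y∈xs , here refl) → proj₁ (proj₂ (All.lookup sound y∈xs)) refl }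
  ; complete = complete′
  ; sound = All.++⁺ (All.map (λ (v≢u , _ , v≢f) → v≢u , v≢f) sound) ((y≢u , y≢f) ∷ [])
  }
  where
  open Enumerates (Enumerates-tail e)
  y≢u : y ≢ u
  y≢u y≡u = proj₁ (All.head (Enumerates.sound e)) (sym y≡u)
  complete′ : ∀ {v} → Others u f v → v ∈ xs ++ y ∷ []
  complete′ {v} (v≢u , v≢f) with v ≟ y
  ... | yes refl = ∈-++⁺ʳ xs (here refl)
  ... | no v≢y = ∈-++⁺ˡ (complete (v≢u , v≢y , v≢f))

allExcept : ∀ {n} → Fin n → List (Fin n)
allExcept {ℕ.suc n} r = tabulate (punchIn r)

allExcept-enumerates : ∀ {n} (r : Fin n) → Enumerates (_≢ r) (allExcept r)
allExcept-enumerates {ℕ.suc n} r = record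
  { unique = Unique.tabulate⁺ (punchIn-injective r _ _)
  ; complete = λ v≢r → subst (_∈ allExcept r) (punchIn-punchOut (v≢r ∘ sym))
                         (∈-tabulate⁺ (punchOut (v≢r ∘ sym)))
  ; sound = All.tabulate⁺ (punchInᵢ≢i r)
  }

allExcept-length : ∀ {n} (r : Fin n) → ℕ.suc (length (allExcept r)) ≡ n
allExcept-length {ℕ.suc n} r = cong ℕ.suc (length-tabulate (punchIn r))


module Forks where

  open import Data.Integer
    using (ℤ; 0ℤ; +_; -_; _+_; _*_; _≤_; _<_; _<?_; +<+; NonNegative; nonNegative)
  open import Data.Integer.Properties hiding (_≟_)
  open import Data.Integer.Tactic.RingSolver using (solve-∀)
  open import Data.Fin.Properties using (any?)
  open import Relation.Nullary.Decidable using (_×-dec_)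

  []₊-of-pos : ∀ {x} → 0ℤ < x → [ x ]₊ ≡ x
  []₊-of-pos = i≥j⇒i⊔j≡i ∘ <⇒≤

  []₊-of-nonpos : ∀ {x} → x ≤ 0ℤ → [ x ]₊ ≡ 0ℤ
  []₊-of-nonpos = i≤j⇒i⊔j≡j

  []₊-nonneg : ∀ x → 0ℤ ≤ [ x ]₊
  []₊-nonneg x = i≤j⊔i x 0ℤ

  []₊*[]₊-of-nonposˡ : ∀ {a} b → a ≤ 0ℤ → [ a ]₊ * [ b ]₊ ≡ 0ℤ
  []₊*[]₊-of-nonposˡ b a≤0 = cong (_* [ b ]₊) ([]₊-of-nonpos a≤0)

  []₊*[]₊-of-nonposʳ : ∀ a {b} → b ≤ 0ℤ → [ a ]₊ * [ b ]₊ ≡ 0ℤ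
  []₊*[]₊-of-nonposʳ a b≤0 = trans (cong ([ a ]₊ *_) ([]₊-of-nonpos b≤0)) (*-zeroʳ [ a ]₊)

  *-nonneg : ∀ {x y} → 0ℤ ≤ x → 0ℤ ≤ y → 0ℤ ≤ x * y
  *-nonneg {y = y} 0≤x 0≤y = *-monoʳ-≤-nonNeg y {{nonNegative 0≤y}} 0≤x

  2≤⇒0< : ∀ {x} → + 2 ≤ x → 0ℤ < x
  2≤⇒0< = <-≤-trans (+<+ (ℕ.s≤s ℕ.z≤n))

  y<a+x*y : ∀ {a x y} → + 2 ≤ x → 0ℤ ≤ y → - a < y → y < a + x * y
  y<a+x*y {a} {x} {y} 2≤x 0≤y -a<y = begin-strict
    y              ≡⟨ regroup a y ⟩
    - a + (a + y)  <⟨ +-monoˡ-< (a + y) -a<y ⟩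
    y + (a + y)    ≡⟨ double a y ⟩
    a + + 2 * y    ≤⟨ +-monoʳ-≤ a (*-monoʳ-≤-nonNeg y {{nonNegative 0≤y}} 2≤x) ⟩
    a + x * y      ∎
    where
    open ≤-Reasoning
    regroup : ∀ a y → y ≡ - a + (a + y)
    regroup = solve-∀
    double : ∀ a y → y + (a + y) ≡ a + + 2 * y
    double = solve-∀

  factors<a+x*y : ∀ {a x y} → + 2 ≤ x → + 2 ≤ y → (- a < x) ⊎ (- a < y) →
    (x < a + x * y) × (y < a + x * y)
  factors<a+x*y {a} {x} {y} 2≤x 2≤y -a<x⊎y with ≤-total x y
  ... | inj₁ x≤y = ≤-<-trans x≤y y< , y<
    where
    y< : y < a + x * y
    y< = y<a+x*y {a} 2≤x (<⇒≤ (2≤⇒0< 2≤y)) ([ (λ -a<x → <-≤-trans -a<x x≤y) , id ]′ -a<x⊎y)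
  ... | inj₂ y≤x = x< , ≤-<-trans y≤x x<
    where
    x< : x < a + x * y
    x< = subst (λ z → x < a + z) (*-comm y x)
           (y<a+x*y {a} 2≤y (<⇒≤ (2≤⇒0< 2≤x)) ([ id , (λ -a<y → <-≤-trans -a<y y≤x) ]′ -a<x⊎y))

  Arrow : {V : Set} → Matrix V → V → V → Set
  Arrow M a b = 0ℤ < M a b

  Abundant⁺ : {V : Set} → Matrix V → Set
  Abundant⁺ M = ∀ i j → i ≢ j → (+ 2 ≤ M i j) ⊎ (+ 2 ≤ M j i)

  TransitiveAwayFrom : {V : Set} → V → Matrix V → Set
  TransitiveAwayFrom r M =
    ∀ {a b c} → a ≢ r → b ≢ r → c ≢ r → Arrow M a b → Arrow M b c → Arrow M a c

  mutablePart-isQuiver : ∀ {n m} {q : IceMatrix n m} → IsQuiver q → IsQuiver (mutablePart q)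
  mutablePart-isQuiver skew a b = skew (inj₁ a) (inj₁ b)

  module SkewSymmetric {V : Set} {M : Matrix V} (skew : IsQuiver M) where

    reverse-entry : ∀ a b → - M b a ≡ M a b
    reverse-entry a b = trans (cong -_ (skew a b)) (neg-involutive (M a b))

    diagonal-zero : ∀ a → M a a ≡ 0ℤ
    diagonal-zero a = self-negating (M a a) (skew a a)
      where
      self-negating : ∀ x → x ≡ - x → x ≡ 0ℤ
      self-negating (+ ℕ.zero) _ = refl

    arrow-irrefl : ∀ {a} → ¬ Arrow M a a
    arrow-irrefl {a} p = <-irrefl (sym (diagonal-zero a)) p

    reverse-nonpos : ∀ {a b} → Arrow M a b → M b a ≤ 0ℤ
    reverse-nonpos {a} {b} p = subst (_≤ 0ℤ) (sym (skew a b)) (neg-mono-≤ (<⇒≤ p))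

    arrow-asym : ∀ {a b} → Arrow M a b → ¬ Arrow M b a
    arrow-asym p q = <-irrefl refl (<-≤-trans q (reverse-nonpos p))

    arrow⇒≢ : ∀ {a b} → Arrow M a b → a ≢ b
    arrow⇒≢ p refl = arrow-irrefl p

    abundant⇒abundant⁺ : Abundant M → Abundant⁺ M
    abundant⇒abundant⁺ abundant i j i≢j with ≤-total 0ℤ (M i j)
    ... | inj₁ 0≤x = inj₁ (subst (+ 2 ≤_) (i≥j⇒i⊔j≡i (≤-trans (neg-mono-≤ 0≤x) 0≤x)) (abundant i j i≢j))
    ... | inj₂ x≤0 = inj₂ (subst (+ 2 ≤_) (trans (i≤j⇒i⊔j≡j (≤-trans x≤0 (neg-mono-≤ x≤0))) (sym (skew i j)))
                            (abundant i j i≢j))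

    abundant⁺⇒abundant : Abundant⁺ M → Abundant M
    abundant⁺⇒abundant abundant i j i≢j with abundant i j i≢j
    ... | inj₁ 2≤x = ≤-trans 2≤x (i≤i⊔j (M i j) (- M i j))
    ... | inj₂ 2≤y = ≤-trans (subst (+ 2 ≤_) (skew i j) 2≤y) (i≤j⊔i (M i j) (- M i j))

    module _ (abundant : Abundant⁺ M) where

      arrow⇒2≤ : ∀ {a b} → Arrow M a b → + 2 ≤ M a b
      arrow⇒2≤ p with abundant _ _ (arrow⇒≢ p)
      ... | inj₁ 2≤x = 2≤x
      ... | inj₂ 2≤y = ⊥-elim (arrow-asym p (2≤⇒0< 2≤y))

      tournament : ∀ {a b} → a ≢ b → Arrow M a b ⊎ Arrow M b a
      tournament a≢b with abundant _ _ a≢b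
      ... | inj₁ 2≤x = inj₁ (2≤⇒0< 2≤x)
      ... | inj₂ 2≤y = inj₂ (2≤⇒0< 2≤y)

  module _ {V : Set} {M : Matrix V} where

    path-source : ∀ {a b} → Path M a b → ∃ (Arrow M a)
    path-source (edge p) = _ , p
    path-source (step p _) = _ , p

    path-target : ∀ {a b} → Path M a b → ∃ λ c → Arrow M c b
    path-target (edge p) = _ , p
    path-target (step _ rest) = path-target rest

  module _ {n : ℕ} {M : Matrix (Fin n)} {r : Fin n} where

    deleteVertex-arrow⁺ : ∀ {a b} → a ≢ r → b ≢ r → Arrow M a b → Arrow (deleteVertex r M) a b
    deleteVertex-arrow⁺ {a} {b} a≢r b≢r p with a ≟ r | b ≟ r
    ... | yes a≡r | _        = ⊥-elim (a≢r a≡r)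
    ... | no _    | yes b≡r  = ⊥-elim (b≢r b≡r)
    ... | no _    | no _     = p

    deleteVertex-arrow⁻ : ∀ {a b} → Arrow (deleteVertex r M) a b → a ≢ r × b ≢ r × Arrow M a b
    deleteVertex-arrow⁻ {a} {b} p with a ≟ r | b ≟ r
    ... | yes _  | _      = ⊥-elim (<-irrefl refl p)
    ... | no _   | yes _  = ⊥-elim (<-irrefl refl p)
    ... | no a≢r | no b≢r = a≢r , b≢r , p

    deleteVertex-path : TransitiveAwayFrom r M →
      ∀ {a b} → Path (deleteVertex r M) a b → a ≢ r × b ≢ r × Arrow M a b
    deleteVertex-path transitive (edge p) = deleteVertex-arrow⁻ p
    deleteVertex-path transitive (step p rest) with deleteVertex-arrow⁻ p | deleteVertex-path transitive rest
    ... | a≢r , b≢r , a→b | _ , c≢r , b→c = a≢r , c≢r , transitive a≢r b≢r c≢r a→b b→c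

    acyclic-deleteVertex : IsQuiver M → TransitiveAwayFrom r M → Acyclic (deleteVertex r M)
    acyclic-deleteVertex skew transitive a cycle =
      SkewSymmetric.arrow-irrefl skew (proj₂ (proj₂ (deleteVertex-path transitive cycle)))

    acyclic-deleteVertex⇒transitive : IsQuiver M → Abundant⁺ M → Acyclic (deleteVertex r M) →
      TransitiveAwayFrom r M
    acyclic-deleteVertex⇒transitive skew abundant acyclic {a} {b} {c} a≢r b≢r c≢r a→b b→c
      with SkewSymmetric.tournament skew abundant {a} {c} (λ { refl → SkewSymmetric.arrow-asym skew a→b b→c })
    ... | inj₁ a→c = a→c
    ... | inj₂ c→a = ⊥-elim (acyclic a (step (deleteVertex-arrow⁺ a≢r b≢r a→b)
                             (step (deleteVertex-arrow⁺ b≢r c≢r b→c) (edge (deleteVertex-arrow⁺ c≢r a≢r c→a)))))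

    path-avoiding : ∀ {a b} → Path M a b → a ≢ r → b ≢ r →
      Path (deleteVertex r M) a b ⊎ ((∃ λ i → Arrow M i r) × ∃ (Arrow M r))
    path-avoiding (edge p) a≢r b≢r = inj₁ (edge (deleteVertex-arrow⁺ a≢r b≢r p))
    path-avoiding (step {b = c} p rest) a≢r b≢r with c ≟ r
    ... | yes refl = inj₂ ((_ , p) , path-source rest)
    ... | no c≢r   = Data.Sum.map₁ (step (deleteVertex-arrow⁺ a≢r c≢r p)) (path-avoiding rest c≢r b≢r)

    -- A cycle of M not surviving the deletion of r must pass through r.
    cycle⇒neighbours : Acyclic (deleteVertex r M) → ∀ {a} → Path M a a →
      (∃ λ i → Arrow M i r) × ∃ (Arrow M r)
    cycle⇒neighbours acyclic {a} cycle with a ≟ r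
    ... | yes refl = path-target cycle , path-source cycle
    ... | no a≢r   = [ ⊥-elim ∘ acyclic a , id ]′ (path-avoiding cycle a≢r a≢r)

    cyclic⇒neighbours : Acyclic (deleteVertex r M) → ¬ Acyclic M →
      (∃ λ i → Arrow M i r) × ∃ (Arrow M r)
    cyclic⇒neighbours acyclic cyclic with any? (λ i → 0ℤ <? M i r) ×-dec any? (λ j → 0ℤ <? M r j)
    ... | yes neighbours = neighbours
    ... | no ¬neighbours = ⊥-elim (cyclic λ a cycle → ¬neighbours (cycle⇒neighbours acyclic cycle))

  module _ {n m : ℕ} {k : Fin n} {q : IceMatrix n m} where

    mutate-from : ∀ b → mutate k q (inj₁ k) b ≡ - q (inj₁ k) b
    mutate-from b with inj₁ {B = Fin m} k ≟V inj₁ k | b ≟V inj₁ k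
    ... | yes _   | _ = refl
    ... | no k≢k  | _ = ⊥-elim (k≢k refl)

    mutate-to : ∀ a → mutate k q a (inj₁ k) ≡ - q a (inj₁ k)
    mutate-to a with a ≟V inj₁ k | inj₁ {B = Fin m} k ≟V inj₁ k
    ... | yes _ | _      = refl
    ... | no _  | yes _  = refl
    ... | no _  | no k≢k = ⊥-elim (k≢k refl)

    mutate-away : ∀ {a b} → a ≢ inj₁ k → b ≢ inj₁ k →
      mutate k q a b ≡ q a b + [ q a (inj₁ k) ]₊ * [ q (inj₁ k) b ]₊ + - ([ q b (inj₁ k) ]₊ * [ q (inj₁ k) a ]₊)
    mutate-away {a} {b} a≢k b≢k with a ≟V inj₁ k | b ≟V inj₁ k
    ... | yes a≡k | _       = ⊥-elim (a≢k a≡k)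
    ... | no _    | yes b≡k = ⊥-elim (b≢k b≡k)
    ... | no _    | no _    = refl

    private
      mutate-antisym : IsQuiver q → ∀ a b → Dec (a ≡ inj₁ k) → Dec (b ≡ inj₁ k) →
        mutate k q b a ≡ - mutate k q a b
      mutate-antisym skew a b (yes refl) _ = begin
        mutate k q b (inj₁ k)      ≡⟨ mutate-to b ⟩
        - q b (inj₁ k)             ≡⟨ cong -_ (skew (inj₁ k) b) ⟩
        - - q (inj₁ k) b           ≡⟨ cong -_ (sym (mutate-from b)) ⟩
        - mutate k q (inj₁ k) b    ∎
        where open ≡-Reasoning
      mutate-antisym skew a b (no _) (yes refl) = begin
        mutate k q (inj₁ k) a      ≡⟨ mutate-from a ⟩
        - q (inj₁ k) a             ≡⟨ cong -_ (skew a (inj₁ k)) ⟩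
        - - q a (inj₁ k)           ≡⟨ cong -_ (sym (mutate-to a)) ⟩
        - mutate k q a (inj₁ k)    ∎
        where open ≡-Reasoning
      mutate-antisym skew a b (no a≢k) (no b≢k) = begin
        mutate k q b a                ≡⟨ mutate-away b≢k a≢k ⟩
        q b a + X + - Y               ≡⟨ cong (λ z → z + X + - Y) (skew a b) ⟩
        - q a b + X + - Y             ≡⟨ negate (q a b) X Y ⟩
        - (q a b + Y + - X)           ≡⟨ cong -_ (sym (mutate-away a≢k b≢k)) ⟩
        - mutate k q a b              ∎
        where
        open ≡-Reasoning
        X Y : ℤ
        X = [ q b (inj₁ k) ]₊ * [ q (inj₁ k) a ]₊
        Y = [ q a (inj₁ k) ]₊ * [ q (inj₁ k) b ]₊
        negate : ∀ x y z → - x + y + - z ≡ - (x + z + - y)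
        negate = solve-∀

    mutate-isQuiver : IsQuiver q → IsQuiver (mutate k q)
    mutate-isQuiver skew a b = mutate-antisym skew a b (a ≟V inj₁ k) (b ≟V inj₁ k)

  module _ {n m : ℕ} {q q' : IceMatrix n m} {i : Fin n} where

    Red-mono : (∀ j → q' (inj₁ i) (inj₂ j) ≤ q (inj₁ i) (inj₂ j)) → Red q i → Red q' i
    Red-mono ≤q ((j , neg) , nonpos) = (j , ≤-<-trans (≤q j) neg) , λ j → ≤-trans (≤q j) (nonpos j)

    Green-mono : (∀ j → q (inj₁ i) (inj₂ j) ≤ q' (inj₁ i) (inj₂ j)) → Green q i → Green q' i
    Green-mono q≤ ((j , pos) , nonneg) = (j , <-≤-trans pos (q≤ j)) , λ j → ≤-trans (nonneg j) (q≤ j)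

  module _ {n m : ℕ} {k : Fin n} {q : IceMatrix n m} where

    private
      flipped : ∀ j → mutate k q (inj₁ k) (inj₂ j) ≡ - q (inj₁ k) (inj₂ j)
      flipped j = mutate-from {k = k} {q = q} (inj₂ j)

    mutate-flips-green : Green q k → Red (mutate k q) k
    mutate-flips-green ((j , pos) , nonneg) =
      (j , subst (_< 0ℤ) (sym (flipped j)) (neg-mono-< pos)) ,
      λ j → subst (_≤ 0ℤ) (sym (flipped j)) (neg-mono-≤ (nonneg j))

    mutate-flips-red : Red q k → Green (mutate k q) k
    mutate-flips-red ((j , neg) , nonpos) =
      (j , subst (0ℤ <_) (sym (flipped j)) (neg-mono-< neg)) ,
      λ j → subst (0ℤ ≤_) (sym (flipped j)) (neg-mono-≤ (nonpos j))

    -- The frozen entries of i change by A - B with A, B ≥ 0; red survives when A vanishes, green when B does.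
    module _ {i : Fin n} (i≢k : i ≢ k) (j : Fin m) where
      private
        qij A B : ℤ
        qij = q (inj₁ i) (inj₂ j)
        A = [ q (inj₁ i) (inj₁ k) ]₊ * [ q (inj₁ k) (inj₂ j) ]₊
        B = [ q (inj₂ j) (inj₁ k) ]₊ * [ q (inj₁ k) (inj₁ i) ]₊

        mutate-frozen : mutate k q (inj₁ i) (inj₂ j) ≡ qij + A + - B
        mutate-frozen = mutate-away {k = k} {q = q} (i≢k ∘ inj₁-injective) λ ()

        B-nonneg : NonNegative B
        B-nonneg = nonNegative (*-nonneg ([]₊-nonneg (q (inj₂ j) (inj₁ k))) ([]₊-nonneg (q (inj₁ k) (inj₁ i))))

        A-nonneg : NonNegative A
        A-nonneg = nonNegative (*-nonneg ([]₊-nonneg (q (inj₁ i) (inj₁ k))) ([]₊-nonneg (q (inj₁ k) (inj₂ j))))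

      frozen-decrease : A ≡ 0ℤ → mutate k q (inj₁ i) (inj₂ j) ≤ qij
      frozen-decrease A≡0 = begin
        mutate k q (inj₁ i) (inj₂ j)  ≡⟨ mutate-frozen ⟩
        qij + A + - B                 ≡⟨ cong (λ z → qij + z + - B) A≡0 ⟩
        qij + 0ℤ + - B                ≤⟨ i-j≤i (qij + 0ℤ) B {{B-nonneg}} ⟩
        qij + 0ℤ                      ≡⟨ +-identityʳ qij ⟩
        qij                           ∎
        where open ≤-Reasoning

      frozen-increase : B ≡ 0ℤ → qij ≤ mutate k q (inj₁ i) (inj₂ j)
      frozen-increase B≡0 = begin
        qij                           ≤⟨ i≤i+j qij A {{A-nonneg}} ⟩
        qij + A                       ≡⟨ sym (+-identityʳ (qij + A)) ⟩
        qij + A + - 0ℤ                ≡⟨ cong (λ z → qij + A + - z) (sym B≡0) ⟩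
        qij + A + - B                 ≡⟨ sym mutate-frozen ⟩
        mutate k q (inj₁ i) (inj₂ j)  ∎
        where open ≤-Reasoning

    mutate-keeps-red : ∀ {i} → i ≢ k → Red q k ⊎ (Green q k × q (inj₁ i) (inj₁ k) ≤ 0ℤ) →
      Red q i → Red (mutate k q) i
    mutate-keeps-red {i} i≢k (inj₁ (_ , k-nonpos)) = Red-mono {q = q} {mutate k q} {i} λ j →
      frozen-decrease i≢k j ([]₊*[]₊-of-nonposʳ (q (inj₁ i) (inj₁ k)) (k-nonpos j))
    mutate-keeps-red {i} i≢k (inj₂ (_ , ik≤0)) = Red-mono {q = q} {mutate k q} {i} λ j →
      frozen-decrease i≢k j ([]₊*[]₊-of-nonposˡ (q (inj₁ k) (inj₂ j)) ik≤0)

    mutate-keeps-green : IsQuiver q → ∀ {i} → i ≢ k → Green q k ⊎ (Red q k × q (inj₁ k) (inj₁ i) ≤ 0ℤ) →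
      Green q i → Green (mutate k q) i
    mutate-keeps-green skew {i} i≢k (inj₁ (_ , k-nonneg)) = Green-mono {q = q} {mutate k q} {i} λ j →
      frozen-increase i≢k j ([]₊*[]₊-of-nonposˡ (q (inj₁ k) (inj₁ i))
        (subst (_≤ 0ℤ) (sym (skew (inj₁ k) (inj₂ j))) (neg-mono-≤ (k-nonneg j))))
    mutate-keeps-green skew {i} i≢k (inj₂ (_ , ki≤0)) = Green-mono {q = q} {mutate k q} {i} λ j →
      frozen-increase i≢k j ([]₊*[]₊-of-nonposʳ (q (inj₂ j) (inj₁ k)) ki≤0)

  -- y is a point of return of M whose only out-neighbour is f; L lists the remaining vertices in the
  -- order of the acyclic quiver M ∖ {y}, f being its source.
  record NormalForm {n : ℕ} (M : Matrix (Fin n)) (y f : Fin n) (L : List (Fin n)) : Set where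
    field
      abundant : Abundant⁺ M
      y→f : Arrow M y f
      f→others : ∀ {v} → Others y f v → Arrow M f v
      others→y : ∀ {v} → Others y f v → Arrow M v y
      return-bound : ∀ {i} → Others y f i → (M i y < M f i) × (M y f < M f i)
      enumerates : Enumerates (Others y f) L
      sorted : AllPairs (Arrow M) L

  module SingleInNeighbour {n m : ℕ} {q : IceMatrix n m} (skew : IsQuiver q) {k e : Fin n}
    (e→k : Arrow (mutablePart q) e k)
    (k→others : ∀ {v} → Others k e v → Arrow (mutablePart q) k v) where

    private
      M M′ : Matrix (Fin n)
      M = mutablePart q
      M′ = mutablePart (mutate k q)

    open SkewSymmetric (mutablePart-isQuiver skew)

    reversed-from : ∀ b → M′ k b ≡ M b k
    reversed-from b = trans (mutate-from {k = k} {q = q} (inj₁ b)) (reverse-entry b k)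

    reversed-to : ∀ a → M′ a k ≡ M k a
    reversed-to a = trans (mutate-to {k = k} {q = q} (inj₁ a)) (reverse-entry k a)

    unchanged : ∀ {a b} → Others k e a → Others k e b → M′ a b ≡ M a b
    unchanged {a} {b} oa@(a≢k , _) ob@(b≢k , _) = begin
      M′ a b
        ≡⟨ mutate-away {k = k} {q = q} (a≢k ∘ inj₁-injective) (b≢k ∘ inj₁-injective) ⟩
      M a b + [ M a k ]₊ * [ M k b ]₊ + - ([ M b k ]₊ * [ M k a ]₊)
        ≡⟨ cong₂ (λ s t → M a b + s + - t)
             ([]₊*[]₊-of-nonposˡ (M k b) (reverse-nonpos (k→others oa)))
             ([]₊*[]₊-of-nonposˡ (M k a) (reverse-nonpos (k→others ob))) ⟩
      M a b + 0ℤ + - 0ℤ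
        ≡⟨ trans (+-identityʳ _) (+-identityʳ _) ⟩
      M a b ∎
      where open ≡-Reasoning

    through : ∀ {b} → Others k e b → M′ e b ≡ M e b + M e k * M k b
    through {b} ob@(b≢k , _) = begin
      M′ e b
        ≡⟨ mutate-away {k = k} {q = q} (arrow⇒≢ e→k ∘ inj₁-injective) (b≢k ∘ inj₁-injective) ⟩
      M e b + [ M e k ]₊ * [ M k b ]₊ + - ([ M b k ]₊ * [ M k e ]₊)
        ≡⟨ cong₂ (λ s t → M e b + s + - t)
             (cong₂ _*_ ([]₊-of-pos e→k) ([]₊-of-pos (k→others ob)))
             ([]₊*[]₊-of-nonposˡ (M k e) (reverse-nonpos (k→others ob))) ⟩
      M e b + M e k * M k b + - 0ℤ
        ≡⟨ +-identityʳ _ ⟩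
      M e b + M e k * M k b ∎
      where open ≡-Reasoning

    mutate-keeps-reds : Red q k ⊎ Green q k → ∀ {xs} → All (Others k e) xs →
      All (Red q) xs → All (Red (mutate k q)) xs
    mutate-keeps-reds colour avoiding reds = All.zipWith
      (λ (ov , red) → mutate-keeps-red (proj₁ ov) (Data.Sum.map₂ (_, reverse-nonpos (k→others ov)) colour) red)
      (avoiding , reds)

    mutate-keeps-green-in-neighbour : Red q k ⊎ Green q k → Green q e → Green (mutate k q) e
    mutate-keeps-green-in-neighbour colour = mutate-keeps-green skew (arrow⇒≢ e→k)
      ([ (λ red → inj₂ (red , reverse-nonpos e→k)) , inj₁ ]′ colour)

    module _ (abundant : Abundant⁺ M)
      (balance : ∀ {b} → Others k e b → (M b e < M e k) ⊎ (M b e < M k b)) where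

      gain : ∀ {b} → Others k e b → (M e k < M′ e b) × (M k b < M′ e b)
      gain {b} ob = subst (λ z → (M e k < z) × (M k b < z)) (sym (through ob))
        (factors<a+x*y (arrow⇒2≤ abundant e→k) (arrow⇒2≤ abundant (k→others ob))
          (Data.Sum.map (subst (_< M e k) (sym (reverse-entry b e))) (subst (_< M k b) (sym (reverse-entry b e)))
            (balance ob)))

      private
        2≤through : ∀ {b} → Others k e b → + 2 ≤ M′ e b
        2≤through ob = <⇒≤ (≤-<-trans (arrow⇒2≤ abundant e→k) (proj₁ (gain ob)))

        abundant-cases : ∀ i j → i ≢ j → Dec (i ≡ k) → Dec (j ≡ k) → Dec (i ≡ e) → Dec (j ≡ e) →
          (+ 2 ≤ M′ i j) ⊎ (+ 2 ≤ M′ j i)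
        abundant-cases i j i≢j (yes refl) _ _ _ =
          Data.Sum.map (subst (+ 2 ≤_) (sym (reversed-from j))) (subst (+ 2 ≤_) (sym (reversed-to j)))
            (Data.Sum.swap (abundant k j i≢j))
        abundant-cases i j i≢j (no _) (yes refl) _ _ =
          Data.Sum.map (subst (+ 2 ≤_) (sym (reversed-to i))) (subst (+ 2 ≤_) (sym (reversed-from i)))
            (Data.Sum.swap (abundant i k i≢j))
        abundant-cases i j i≢j (no _) (no j≢k) (yes refl) _ = inj₁ (2≤through (j≢k , i≢j ∘ sym))
        abundant-cases i j i≢j (no i≢k) (no _) (no _) (yes refl) = inj₂ (2≤through (i≢k , i≢j))
        abundant-cases i j i≢j (no i≢k) (no j≢k) (no i≢e) (no j≢e) =
          Data.Sum.map (subst (+ 2 ≤_) (sym (unchanged (i≢k , i≢e) (j≢k , j≢e))))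
            (subst (+ 2 ≤_) (sym (unchanged (j≢k , j≢e) (i≢k , i≢e))))
            (abundant i j i≢j)

      mutate-abundant : Abundant⁺ M′
      mutate-abundant i j i≢j = abundant-cases i j i≢j (i ≟ k) (j ≟ k) (i ≟ e) (j ≟ e)

      mutate-normalForm : ∀ {L} → Enumerates (Others k e) L → AllPairs (Arrow M) L → NormalForm M′ k e L
      mutate-normalForm enumerates sorted = record
        { abundant = mutate-abundant
        ; y→f = subst (0ℤ <_) (sym (reversed-from e)) e→k
        ; f→others = λ ov → <-trans e→k (proj₁ (gain ov))
        ; others→y = λ {v} ov → subst (0ℤ <_) (sym (reversed-to v)) (k→others ov)
        ; return-bound = λ {i} oi → subst (_< M′ e i) (sym (reversed-to i)) (proj₂ (gain oi)) ,
                                    subst (_< M′ e i) (sym (reversed-from e)) (proj₁ (gain oi))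
        ; enumerates = enumerates
        ; sorted = AllPairs-mapWithin (λ oa ob → subst (0ℤ <_) (sym (unchanged oa ob)))
                     (Enumerates.sound enumerates) sorted
        }

  module _ {n : ℕ} {M : Matrix (Fin n)} (skew : IsQuiver M) {y f L} (normal : NormalForm M y f L) where
    open NormalForm normal
    open Enumerates enumerates
    open SkewSymmetric skew

    normalForm-transitive : TransitiveAwayFrom y M
    normalForm-transitive {a} {b} {c} a≢y b≢y c≢y a→b b→c with a ≟ f | b ≟ f | c ≟ f
    ... | _        | yes refl | _        = ⊥-elim (arrow-asym a→b (f→others (a≢y , arrow⇒≢ a→b)))
    ... | _        | no b≢f   | yes refl = ⊥-elim (arrow-asym b→c (f→others (b≢y , b≢f)))
    ... | yes refl | no _     | no c≢f   = f→others (c≢y , c≢f)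
    ... | no a≢f   | no b≢f   | no c≢f   =
      AllPairs-trans arrow-asym sorted (complete (a≢y , a≢f)) (complete (b≢y , b≢f)) (complete (c≢y , c≢f)) a→b b→c

    normalForm-pointOfReturn : IsPointOfReturn M y
    normalForm-pointOfReturn = returning , acyclic-deleteVertex skew normalForm-transitive
      where
      returning : ∀ i j → Arrow M i y → Arrow M y j → (M i y < M j i) × (M y j < M j i)
      returning i j i→y y→j with j ≟ f
      ... | yes refl = return-bound (arrow⇒≢ i→y , λ { refl → arrow-asym y→f i→y })
      ... | no j≢f   = ⊥-elim (arrow-asym y→j (others→y (arrow⇒≢ y→j ∘ sym , j≢f)))

    normalForm⇒fork : ∀ {x} → x ∈ L → Fork M
    normalForm⇒fork {x} x∈L =
      abundant⁺⇒abundant abundant ,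
      (λ acyclic → acyclic y (step y→f (step (f→others ox) (edge (others→y ox))))) ,
      y , normalForm-pointOfReturn
      where
      ox : Others y f x
      ox = All.lookup sound x∈L

  module TopologicalOrder {n : ℕ} {M : Matrix (Fin n)} (skew : IsQuiver M) (abundant : Abundant⁺ M)
    {r : Fin n} (transitive : TransitiveAwayFrom r M) where
    open SkewSymmetric skew

    private
      -- r is put below all other vertices only to make the order total on Fin n.
      _≼_ : Fin n → Fin n → Set
      a ≼ b = a ≡ b ⊎ a ≡ r ⊎ (a ≢ r × b ≢ r × Arrow M a b)

      ≼-trans : ∀ {a b c} → a ≼ b → b ≼ c → a ≼ c
      ≼-trans (inj₁ refl) b≼c = b≼c
      ≼-trans (inj₂ (inj₁ a≡r)) _ = inj₂ (inj₁ a≡r)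
      ≼-trans (inj₂ (inj₂ a→b)) (inj₁ refl) = inj₂ (inj₂ a→b)
      ≼-trans (inj₂ (inj₂ (_ , b≢r , _))) (inj₂ (inj₁ b≡r)) = ⊥-elim (b≢r b≡r)
      ≼-trans (inj₂ (inj₂ (a≢r , b≢r , a→b))) (inj₂ (inj₂ (_ , c≢r , b→c))) =
        inj₂ (inj₂ (a≢r , c≢r , transitive a≢r b≢r c≢r a→b b→c))

      ≼-antisym : ∀ {a b} → a ≼ b → b ≼ a → a ≡ b
      ≼-antisym (inj₁ a≡b) _ = a≡b
      ≼-antisym (inj₂ _) (inj₁ b≡a) = sym b≡a
      ≼-antisym (inj₂ (inj₁ a≡r)) (inj₂ (inj₁ b≡r)) = trans a≡r (sym b≡r)
      ≼-antisym (inj₂ (inj₁ a≡r)) (inj₂ (inj₂ (_ , a≢r , _))) = ⊥-elim (a≢r a≡r)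
      ≼-antisym (inj₂ (inj₂ (_ , b≢r , _))) (inj₂ (inj₁ b≡r)) = ⊥-elim (b≢r b≡r)
      ≼-antisym (inj₂ (inj₂ (_ , _ , a→b))) (inj₂ (inj₂ (_ , _ , b→a))) = ⊥-elim (arrow-asym a→b b→a)

      ≼-total : ∀ a b → a ≼ b ⊎ b ≼ a
      ≼-total a b with a ≟ r | b ≟ r | a ≟ b
      ... | yes a≡r | _       | _       = inj₁ (inj₂ (inj₁ a≡r))
      ... | no _    | yes b≡r | _       = inj₂ (inj₂ (inj₁ b≡r))
      ... | no _    | no _    | yes a≡b = inj₁ (inj₁ a≡b)
      ... | no a≢r  | no b≢r  | no a≢b with tournament abundant a≢b
      ...   | inj₁ a→b = inj₁ (inj₂ (inj₂ (a≢r , b≢r , a→b)))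
      ...   | inj₂ b→a = inj₂ (inj₂ (inj₂ (b≢r , a≢r , b→a)))

      order : DecTotalOrder _ _ _
      order = record
        { isDecTotalOrder = record
          { isTotalOrder = record
            { isPartialOrder = record
              { isPreorder = record { isEquivalence = isEquivalence ; reflexive = inj₁ ; trans = ≼-trans }
              ; antisym = ≼-antisym
              }
            ; total = ≼-total
            }
          ; _≟_ = _≟_
          ; _≤?_ = total∧dec⇒dec inj₁ ≼-antisym ≼-total _≟_
          }
        }

      open Sort order using (sort; sort-↭; sort-↗)

      ≼⇒arrow : ∀ {a b} → a ≢ r → b ≢ r → a ≼ b × a ≢ b → Arrow M a b
      ≼⇒arrow _   _ (inj₁ a≡b , a≢b) = ⊥-elim (a≢b a≡b)
      ≼⇒arrow a≢r _ (inj₂ (inj₁ a≡r) , _) = ⊥-elim (a≢r a≡r)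
      ≼⇒arrow _   _ (inj₂ (inj₂ (_ , _ , a→b)) , _) = a→b

    topologicalOrder : List (Fin n)
    topologicalOrder = sort (allExcept r)

    topologicalOrder-enumerates : Enumerates (_≢ r) topologicalOrder
    topologicalOrder-enumerates = Enumerates-resp-↭ (↭-sym (sort-↭ (allExcept r))) (allExcept-enumerates r)

    topologicalOrder-sorted : AllPairs (Arrow M) topologicalOrder
    topologicalOrder-sorted = AllPairs-mapWithin ≼⇒arrow sound
      (AllPairs.zip (Linked⇒AllPairs ≼-trans (sort-↗ (allExcept r)) , unique))
      where open Enumerates topologicalOrder-enumerates

    topologicalOrder-length : ℕ.suc (length topologicalOrder) ≡ n
    topologicalOrder-length = trans (cong ℕ.suc (↭-length (sort-↭ (allExcept r)))) (allExcept-length r)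

  module SourceOfOrder {n : ℕ} {M : Matrix (Fin n)} (skew : IsQuiver M) (abundant : Abundant⁺ M) {r : Fin n}
    (returning : ∀ i j → Arrow M i r → Arrow M r j → (M i r < M j i) × (M r j < M j i))
    {w rest} (enumerates : Enumerates (_≢ r) (w ∷ rest)) (sorted : AllPairs (Arrow M) (w ∷ rest)) where
    open SkewSymmetric skew
    open Enumerates enumerates

    w≢r : w ≢ r
    w≢r = All.head sound

    w→others : ∀ {v} → Others w r v → Arrow M w v
    w→others (v≢w , v≢r) with complete v≢r
    ... | here v≡w = ⊥-elim (v≢w v≡w)
    ... | there v∈rest = All.lookup (AllPairs.head sorted) v∈rest

    -- If w → r instead, the point-of-return inequality for w → r → j would force j → w.
    r→w : ∃ (Arrow M r) → Arrow M r w
    r→w (j , r→j) with tournament abundant (w≢r ∘ sym)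
    ... | inj₁ r→w = r→w
    ... | inj₂ w→r with complete (arrow⇒≢ r→j ∘ sym)
    ...   | here refl    = r→j
    ...   | there j∈rest =
      ⊥-elim (arrow-asym (All.lookup (AllPairs.head sorted) j∈rest) (<-trans w→r (proj₁ (returning w j w→r r→j))))

    in-neighbour∈rest : Arrow M r w → ∃ (λ i → Arrow M i r) → ∃ (_∈ rest)
    in-neighbour∈rest r→w (i , i→r) with complete (arrow⇒≢ i→r)
    ... | here refl    = ⊥-elim (arrow-asym r→w i→r)
    ... | there i∈rest = i , i∈rest

    balance : Arrow M r w → ∀ {b} → Others w r b → (M b r < M r w) ⊎ (M b r < M w b)
    balance r→w {b} (_ , b≢r) with tournament abundant (b≢r ∘ sym)
    ... | inj₁ r→b = inj₁ (≤-<-trans (reverse-nonpos r→b) r→w)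
    ... | inj₂ b→r = inj₂ (proj₁ (returning b w b→r r→w))

  -- The first mutation, at the source w of the acyclic quiver F ∖ {r}.
  record SourceMutation {n m : ℕ} (q : IceMatrix n m) : Set where
    field
      source returnPoint : Fin n
      queue : List (Fin n)
      normal : NormalForm (mutablePart (mutate source q)) source returnPoint queue
      queue-nonempty : ∃ (_∈ queue)
      queue-length : ℕ.suc (ℕ.suc (length queue)) ≡ n

  fork⇒sourceMutation : ∀ {n m} {q : IceMatrix n m} → IsQuiver q → Fork (mutablePart q) → SourceMutation q
  fork⇒sourceMutation {n} {m} {q} skew (abundant , cyclic , r , returning , acyclic) =
    fromOrder topologicalOrder topologicalOrder-enumerates topologicalOrder-sorted topologicalOrder-length
    where
    M : Matrix (Fin n)
    M = mutablePart q
    skewM : IsQuiver M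
    skewM = mutablePart-isQuiver skew
    abundant⁺ : Abundant⁺ M
    abundant⁺ = SkewSymmetric.abundant⇒abundant⁺ skewM abundant
    open TopologicalOrder skewM abundant⁺ (acyclic-deleteVertex⇒transitive skewM abundant⁺ acyclic)
    open SkewSymmetric skewM using (arrow⇒≢)
    in-neighbour : ∃ λ i → Arrow M i r
    in-neighbour = proj₁ (cyclic⇒neighbours acyclic cyclic)
    out-neighbour : ∃ (Arrow M r)
    out-neighbour = proj₂ (cyclic⇒neighbours acyclic cyclic)

    fromOrder : ∀ S → Enumerates (_≢ r) S → AllPairs (Arrow M) S → ℕ.suc (length S) ≡ n → SourceMutation q
    fromOrder [] enumerates _ _ with Enumerates.complete enumerates (arrow⇒≢ (proj₂ out-neighbour) ∘ sym)
    ... | ()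
    fromOrder (w ∷ rest) enumerates sorted length-S = record
      { normal = SingleInNeighbour.mutate-normalForm skew r→w′ w→others abundant⁺ (balance r→w′)
                   (Enumerates-tail enumerates) (AllPairs.tail sorted)
      ; queue-nonempty = in-neighbour∈rest r→w′ in-neighbour
      ; queue-length = length-S
      }
      where
      open SourceOfOrder skewM abundant⁺ returning enumerates sorted
      r→w′ : Arrow M r w
      r→w′ = r→w out-neighbour

  -- U is the part of the queue still to be processed, R the part already made red.
  record Configuration {n m : ℕ} (q : IceMatrix n m) (y f : Fin n) (U R : List (Fin n)) : Set where
    field
      quiver : IsQuiver q
      coherent : StrictlySignCoherent q
      normal : NormalForm (mutablePart q) y f (U ++ R)
      reds : All (Red q) R

  module _ {n m : ℕ} {q : IceMatrix n m} {y f : Fin n} {U R : List (Fin n)} (c : Configuration q y f U R) where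
    open Configuration c
    open NormalForm normal
    private
      module S = SingleInNeighbour quiver y→f (f→others ∘ Data.Product.swap)

    mutate-at-f : Configuration (mutate f q) f y U R
    mutate-at-f = record
      { quiver = mutate-isQuiver quiver
      ; coherent = λ ks → coherent (f ∷ ks)
      ; normal = normal′
      ; reds = S.mutate-keeps-reds (coherent [] f) (All.++⁻ʳ U (Enumerates.sound (NormalForm.enumerates normal′))) reds
      }
      where
      normal′ = S.mutate-normalForm abundant (λ ob → inj₂ (proj₁ (return-bound (Data.Product.swap ob))))
                  (Enumerates-cong Data.Product.swap Data.Product.swap enumerates) sorted

    mutate-at-f-keeps-green : Green q y → Green (mutate f q) y
    mutate-at-f-keeps-green = S.mutate-keeps-green-in-neighbour (coherent [] f)

  module _ {n m : ℕ} {q : IceMatrix n m} {y f u : Fin n} {U R : List (Fin n)}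
    (c : Configuration q y f (u ∷ U) R) where
    open Configuration c
    open NormalForm normal
    open Enumerates enumerates
    open SkewSymmetric (mutablePart-isQuiver quiver)
    private
      ou : Others y f u
      ou = All.head sound

      u→others : ∀ {v} → Others u f v → Arrow (mutablePart q) u v
      u→others {v} (v≢u , v≢f) with v ≟ y
      ... | yes refl = others→y ou
      ... | no v≢y with complete (v≢y , v≢f)
      ...   | here v≡u = ⊥-elim (v≢u v≡u)
      ...   | there v∈ = All.lookup (AllPairs.head sorted) v∈

      balance : ∀ {b} → Others u f b →
        (mutablePart q b f < mutablePart q f u) ⊎ (mutablePart q b f < mutablePart q u b)
      balance {b} (_ , b≢f) with b ≟ y
      ... | yes refl = inj₁ (proj₂ (return-bound ou))
      ... | no b≢y   = inj₁ (≤-<-trans (reverse-nonpos (f→others (b≢y , b≢f))) (f→others ou))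

      module S = SingleInNeighbour quiver (f→others ou) u→others

      normal′ : NormalForm (mutablePart (mutate u q)) u f (U ++ R ++ y ∷ [])
      normal′ = subst (NormalForm (mutablePart (mutate u q)) u f) (++-assoc U R (y ∷ []))
        (S.mutate-normalForm abundant balance (Enumerates-rotate _≟_ (arrow⇒≢ y→f) enumerates)
          (AllPairs.++⁺ (AllPairs.tail sorted) ([] ∷ []) (All.map (λ ov → others→y ov ∷ []) (All.tail sound))))

    mutate-at-head : Red q y → Configuration (mutate u q) u f U (R ++ y ∷ [])
    mutate-at-head y-red = record
      { quiver = mutate-isQuiver quiver
      ; coherent = λ ks → coherent (u ∷ ks)
      ; normal = normal′
      ; reds = S.mutate-keeps-reds (coherent [] u) (All.++⁻ʳ U (Enumerates.sound (NormalForm.enumerates normal′)))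
                 (All.++⁺ reds (y-red ∷ []))
      }

    mutate-at-head-keeps-green : Green q f → Green (mutate u q) f
    mutate-at-head-keeps-green = S.mutate-keeps-green-in-neighbour (coherent [] u)

open Forks
open import Data.Nat using (_≤_; _+_; _*_; _∸_; z≤n; s≤s)
open import Data.Nat.Properties using (≤-reflexive; ≤-trans; n≤1+n; m≤m+n; +-mono-≤; *-suc)
open import Data.Nat.Tactic.RingSolver using (solve-∀)
open import Data.List.Properties using (length-++; foldl-++; ++-identityʳ)

module _ {n m : ℕ} where

  record _⇝⟨_⟩_ (q : IceMatrix n m) (B : ℕ) (P : IceMatrix n m → Set) : Set where
    constructor reach
    field
      sequence : List (Fin n)
      sequence-length : length sequence ≤ B
      reached : P (mutateSeq sequence q)

  module _ {P : IceMatrix n m → Set} where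

    ⇝-witness : ∀ {q B} → q ⇝⟨ B ⟩ P → Σ (List (Fin n)) λ ks → length ks ≤ B × P (mutateSeq ks q)
    ⇝-witness (reach ks length≤ p) = ks , length≤ , p

    done : ∀ {q} → P q → q ⇝⟨ 0 ⟩ P
    done p = reach [] z≤n p

    mutate-then : ∀ {q B} k → mutate k q ⇝⟨ B ⟩ P → q ⇝⟨ ℕ.suc B ⟩ P
    mutate-then k (reach ks length≤ p) = reach (k ∷ ks) (s≤s length≤) p

    ⇝-mono : ∀ {q B B′} → B ≤ B′ → q ⇝⟨ B ⟩ P → q ⇝⟨ B′ ⟩ P
    ⇝-mono B≤B′ (reach ks length≤ p) = reach ks (≤-trans length≤ B≤B′) p

    _>>=_ : ∀ {Q q B C} → q ⇝⟨ B ⟩ P → (∀ {q′} → P q′ → q′ ⇝⟨ C ⟩ Q) → q ⇝⟨ B + C ⟩ Q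
    _>>=_ {Q} {q} (reach ks length≤ p) next with next p
    ... | reach ks′ length′≤ p′ =
      reach (ks ++ ks′)
        (subst (_≤ _) (sym (length-++ ks)) (+-mono-≤ length≤ length′≤))
        (subst Q (sym (foldl-++ (λ acc k → mutate k acc) q ks ks′)) p′)

  Goal : IceMatrix n m → Set
  Goal q = Fork (mutablePart q) × Σ (List (Fin n)) (λ reds →
             Unique reds × All (Red q) reds × (n ∸ 1 ≤ length reds))

  record Ready (U R : List (Fin n)) (q : IceMatrix n m) : Set where
    field
      y f : Fin n
      configuration : Configuration q y f U R
      y-red : Red q y
      f-green : Green q f

  module _ {U R : List (Fin n)} where

    settle-green-f : ∀ {q y f} → Configuration q y f U R → Green q f → q ⇝⟨ 1 ⟩ Ready U R
    settle-green-f {q} {y} {f} c f-green with Configuration.coherent c [] y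
    ... | inj₁ y-red   = ⇝-mono z≤n (done (record { configuration = c ; y-red = y-red ; f-green = f-green }))
    ... | inj₂ y-green = mutate-then f (done (record
      { configuration = mutate-at-f c
      ; y-red = mutate-flips-green {k = f} {q = q} f-green
      ; f-green = mutate-at-f-keeps-green c y-green
      }))

    settle-green-y : ∀ {q y f} → Configuration q y f U R → Green q y → q ⇝⟨ 2 ⟩ Ready U R
    settle-green-y {f = f} c y-green with Configuration.coherent c [] f
    ... | inj₁ f-red   = mutate-then f (settle-green-f (mutate-at-f c) (mutate-at-f-keeps-green c y-green))
    ... | inj₂ f-green = ⇝-mono (n≤1+n 1) (settle-green-f c f-green)

    settle : ∀ {q y f} → Configuration q y f U R → q ⇝⟨ 3 ⟩ Ready U R
    settle {q} {f = f} c with Configuration.coherent c [] f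
    ... | inj₁ f-red   = mutate-then f (settle-green-y (mutate-at-f c) (mutate-flips-red {k = f} {q = q} f-red))
    ... | inj₂ f-green = ⇝-mono (s≤s z≤n) (settle-green-f c f-green)

  advance : ∀ {q u U R} (s : Ready (u ∷ U) R q) → q ⇝⟨ 2 ⟩ Ready U (R ++ Ready.y s ∷ [])
  advance {u = u} s =
    mutate-then u (settle-green-f (mutate-at-head configuration y-red) (mutate-at-head-keeps-green configuration f-green))
    where open Ready s

  finish : ∀ {q R x} → x ∈ R → Ready [] R q → Goal q
  finish {q} x∈R s =
    normalForm⇒fork (mutablePart-isQuiver quiver) normal x∈R ,
    allExcept f , unique , All.map red sound , ≤-reflexive (cong (_∸ 1) (sym (allExcept-length f)))
    where
    open Ready s
    open Configuration configuration
    open Enumerates (allExcept-enumerates f)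
    red : ∀ {v} → v ≢ f → Red q v
    red {v} v≢f with v ≟ y
    ... | yes refl = y-red
    ... | no v≢y   = All.lookup reds (Enumerates.complete (NormalForm.enumerates normal) (v≢y , v≢f))

  loop : ∀ U {R q x} → x ∈ U ++ R → Ready U R q → q ⇝⟨ 2 * length U ⟩ Goal
  loop [] x∈R s = ⇝-mono z≤n (done (finish x∈R s))
  loop (u ∷ U) {R} _ s = ⇝-mono (≤-reflexive (sym (*-suc 2 (length U))))
    (advance s >>= loop U (∈-++⁺ʳ U (∈-++⁺ʳ R (here refl))))

mutation-count : ∀ k → ℕ.suc (3 + 2 * k) ≤ 2 * ℕ.suc (ℕ.suc k) + 3
mutation-count k = ≤-trans (≤-reflexive (count k)) (m≤m+n _ 3)
  where
  count : ∀ k → ℕ.suc (3 + 2 * k) ≡ 2 * ℕ.suc (ℕ.suc k)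
  count = solve-∀

theorem4p10 : (n m : ℕ) (q : IceMatrix n m)
    → IsQuiver q
    → StrictlySignCoherent q
    → Fork (mutablePart q)
    → Σ (List (Fin n)) (λ ks →
        (length ks ≤ 2 * n + 3)
        × Fork (mutablePart (mutateSeq ks q))
        × Σ (List (Fin n)) (λ reds →
            Unique reds × All (Red (mutateSeq ks q)) reds × (n ∸ 1 ≤ length reds)))
theorem4p10 n m q quiver coherent fork =
  ⇝-witness (⇝-mono (subst (λ N → ℕ.suc (3 + 2 * length queue) ≤ 2 * N + 3) queue-length
                         (mutation-count (length queue)))
               mutations)
  where
  open SourceMutation (fork⇒sourceMutation quiver fork)
  initial : Configuration (mutate source q) source returnPoint queue []
  initial = record
    { quiver = mutate-isQuiver quiver
    ; coherent = λ ks → coherent (source ∷ ks)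
    ; normal = subst (NormalForm _ source returnPoint) (sym (++-identityʳ queue)) normal
    ; reds = []
    }
  mutations : q ⇝⟨ ℕ.suc (3 + 2 * length queue) ⟩ Goal
  mutations = mutate-then source (settle initial >>= loop queue (∈-++⁺ˡ (proj₂ queue-nonempty)))
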